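{- Let $\Sigma$ be an alphabet with $|\Sigma| = s$ and let $W$ be an arbitrary word of length $w$ over $\Sigma$. Then for any integer $d$ with $0 \le d < w$, $$|CN(W,d)| \le \sum_{i=0}^{d} \binom{w}{i} (s-1)^{d-i} \sum_{j=0}^{d-i} \binom{w-i-1}{j} \binom{w+d-2i-2j-1}{d-i-j}.$$
   Context: For words $U,V$ over $\Sigma$, the Levenshtein distance $d_{lev}(U,V)$ is the minimum number of single-character insertions, deletions and substitutions transforming $U$ into $V$. $N(W,d) = \{U \in \Sigma^* : d_{lev}(U,W) \le d\}$ and the condensed $d$-neighborhood $CN(W,d) = N(W,d)\setminus N(W,d)\Sigma^+$ is the set of words of $N(W,d)$ having no proper prefix in $N(W,d)$. The convention $0^0=1$ is used. -}

module Defs where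

open import Data.Nat using (ℕ; zero; suc; _+_; _*_; _∸_; _^_; _≤_; _<_)
open import Data.Nat.Combinatorics using (_C_)
open import Data.Fin using (Fin)
open import Data.List using (List; []; _∷_; _++_; length; map; upTo)
open import Data.Nat.ListAction using (sum)
open import Data.Product using (Σ; ∃; _×_)
open import Relation.Nullary using (¬_)
open import Relation.Binary.PropositionalEquality using (_≡_)

Word : ℕ → Set
Word s = List (Fin s)

data Step {s : ℕ} : Word s → Word s → Set where
  ins : (u v : Word s) (a : Fin s) → Step (u ++ v) (u ++ (a ∷ v))
  del : (u v : Word s) (a : Fin s) → Step (u ++ (a ∷ v)) (u ++ v)
  sub : (u v : Word s) (a b : Fin s) → Step (u ++ (a ∷ v)) (u ++ (b ∷ v))

data Edits {s : ℕ} : ℕ → Word s → Word s → Set where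
  done : (u : Word s) → Edits zero u u
  step : {k : ℕ} {u v x : Word s} → Step u v → Edits k v x → Edits (suc k) u x

LevLe : {s : ℕ} → Word s → Word s → ℕ → Set
LevLe U V d = ∃ λ k → k ≤ d × Edits k U V

InN : {s : ℕ} → Word s → ℕ → Word s → Set
InN W d U = LevLe U W d

-- U ∈ CN(W,d) = N(W,d) \ N(W,d) Σ⁺ : U ∈ N(W,d) and U is not of the form P y
-- with P ∈ N(W,d) and y a nonempty word.
InCN : {s : ℕ} → Word s → ℕ → Word s → Set
InCN {s} W d U =
  InN W d U ×
  ¬ (Σ (Word s) λ P → Σ (Fin s) λ c → Σ (Word s) λ y →
       (U ≡ P ++ (c ∷ y)) × InN W d P)

sumTo : ℕ → (ℕ → ℕ) → ℕ
sumTo n f = sum (map f (upTo (suc n)))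

-- ∑_{i=0}^{d} C(w,i) (s-1)^{d-i} ∑_{j=0}^{d-i} C(w-i-1,j) C(w+d-2i-2j-1,d-i-j)
-- (all subtractions are nonnegative whenever d < w, so truncated ∸ is exact)
bound : ℕ → ℕ → ℕ → ℕ
bound s w d =
  sumTo d λ i →
    (w C i) * ((s ∸ 1) ^ (d ∸ i)) *
    sumTo (d ∸ i) λ j →
      ((w ∸ i ∸ 1) C j) * (((w + d) ∸ (2 * i) ∸ (2 * j) ∸ 1) C (d ∸ i ∸ j))

{-# OPTIONS --safe #-}
module Submission where

-- No proper prefix of U lies within distance d of W, so U is not
-- within distance d - 1 of W (dropping its last letter costs one more edit), and in no alignment
-- of cost d is the last letter of U inserted or substituted.  Excluding these two escapes is
-- exactly what lets an alignment of cost d be normalised into a canonical one: inserted letters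
-- come in blocks right before a matched letter of W and differ from it, substituted letters
-- differ from the letter they replace, and U ends with a match.  A canonical alignment with
-- i deletions, j substitutions, f + 1 matches and m = d - i - j insertions is determined by the
-- deleted positions (w C i), the substituted letters among the first w - i - 1 retained ones
-- ((w - i - 1) C j), the distribution of the m insertions over the f + 1 matches as a
-- stars-and-bars word of length f + m = w + d - 2i - 2j - 1, and the d - i new letters, each
-- avoiding one letter of W ((s - 1)^(d - i)).  Hence CN(W,d) is contained in a list of decoded
-- words of length bound s w d.

open import Defs
open import Level using (0ℓ)
open import Data.Bool using (Bool; true; false)
open import Data.Fin using (Fin; _≟_; punchIn; punchOut)
open import Data.Fin.Properties using (punchIn-punchOut)
open import Data.List
  using (List; []; _∷_; _++_; _∷ʳ_; [_]; length; replicate; map; concatMap; upTo; allFin; initLast; _∷ʳ′_)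
open import Data.List.Effectful using (monad)
open import Data.List.Properties
  using (++-assoc; ++-identityʳ; length-++; length-map; length-replicate; length-tabulate; length-++-sucʳ)
open import Data.List.Membership.Propositional using (_∈_; lose)
open import Data.List.Membership.Propositional.Properties
  using (∈-map⁺; ∈-++⁺ˡ; ∈-++⁺ʳ; ∈-++⁻; ∈-∃++; ∈-allFin; ∈-upTo⁺; ∈-concatMap⁺)
open import Data.List.Relation.Binary.Subset.Propositional using (_⊆_)
open import Data.List.Relation.Unary.All as All using (All; []; _∷_)
open import Data.List.Relation.Unary.AllPairs using ([]; _∷_)
open import Data.List.Relation.Unary.Any using (here; there)
open import Data.List.Relation.Unary.Unique.Propositional using (Unique)
open import Data.Nat
  using (ℕ; zero; suc; _+_; _*_; _∸_; _^_; _≤_; _<_; _≤′_; ≤′-refl; ≤′-step; z≤n; s≤s)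
open import Data.Nat.Combinatorics using (_C_; nCk+nC[k+1]≡[n+1]C[k+1])
open import Data.Nat.ListAction using (sum)
open import Data.Nat.Properties
  using ( +-suc; +-comm; *-assoc; +-monoʳ-<; m+n∸m≡n; m≤m+n; m≤n⇒m≤1+n; n<1+n; ≤⇒≤′
        ; <⇒≱; <-trans; <-irrefl; module ≤-Reasoning)
open import Data.Nat.Tactic.RingSolver using (solve-∀)
open import Data.Product using (∃; ∃₂; _×_; _,_)
open import Data.Sum using (_⊎_; inj₁; inj₂)
open import Effect.Monad using (RawMonad)
open import Function using (_∘_; id)
open import Relation.Nullary using (¬_; yes; no; contradiction)
open import Relation.Binary.PropositionalEquality
  using (_≡_; _≢_; refl; sym; trans; cong; cong₂; subst; subst₂; module ≡-Reasoning)

open RawMonad (monad {0ℓ}) using (_>>=_)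

module _ {A : Set} where

  ∈-++-∷⁻ : ∀ as {bs} {x y : A} → y ∈ as ++ x ∷ bs → x ≢ y → y ∈ as ++ bs
  ∈-++-∷⁻ as y∈ x≢y with ∈-++⁻ as y∈
  ... | inj₁ y∈as         = ∈-++⁺ˡ y∈as
  ... | inj₂ (here refl)  = contradiction refl x≢y
  ... | inj₂ (there y∈bs) = ∈-++⁺ʳ as y∈bs

  Unique⇒length≤ : {xs ys : List A} → Unique xs → xs ⊆ ys → length xs ≤ length ys
  Unique⇒length≤ {[]}     _                 _     = z≤n
  Unique⇒length≤ {x ∷ xs} (x∉xs ∷ xs-unique) xs⊆ys
    with as , bs , refl ← ∈-∃++ (xs⊆ys (here refl))
    rewrite length-++-sucʳ as x bs
    = s≤s (Unique⇒length≤ xs-unique λ y∈xs →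
             ∈-++-∷⁻ as (xs⊆ys (there y∈xs)) (All.lookup x∉xs y∈xs))

module _ {A B : Set} where

  length-concatMap : ∀ (f : A → List B) {g : A → ℕ} xs → (∀ x → length (f x) ≡ g x) →
                     length (concatMap f xs) ≡ sum (map g xs)
  length-concatMap f []       _   = refl
  length-concatMap f (x ∷ xs) f≡g =
    trans (length-++ (f x)) (cong₂ _+_ (f≡g x) (length-concatMap f xs f≡g))

  length-concatMap-const : ∀ (f : A → List B) {c} xs → (∀ x → length (f x) ≡ c) →
                           length (concatMap f xs) ≡ length xs * c
  length-concatMap-const f []       _   = refl
  length-concatMap-const f (x ∷ xs) f≡c =
    trans (length-++ (f x)) (cong₂ _+_ (f≡c x) (length-concatMap-const f xs f≡c))

  ∈-concatMap : ∀ (f : A → List B) {x y xs} → x ∈ xs → y ∈ f x → y ∈ concatMap f xs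
  ∈-concatMap f x∈xs y∈fx = ∈-concatMap⁺ f (lose x∈xs y∈fx)

module _ {A : Set} where

  allLists : List A → ℕ → List (List A)
  allLists xs zero    = [ [] ]
  allLists xs (suc n) = concatMap (λ x → map (x ∷_) (allLists xs n)) xs

  length-allLists : ∀ xs n → length (allLists xs n) ≡ length xs ^ n
  length-allLists xs zero    = refl
  length-allLists xs (suc n) =
    trans (length-concatMap-const (λ x → map (x ∷_) (allLists xs n)) xs
                                  (λ x → length-map (x ∷_) (allLists xs n)))
          (cong (length xs *_) (length-allLists xs n))

  ∈-allLists : ∀ {xs n} ys → All (_∈ xs) ys → length ys ≡ n → ys ∈ allLists xs n
  ∈-allLists []       []             refl = here refl
  ∈-allLists {xs} (y ∷ ys) (y∈xs ∷ ys⊆xs) refl =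
    ∈-concatMap (λ x → map (x ∷_) (allLists xs (length ys))) y∈xs
                (∈-map⁺ (y ∷_) (∈-allLists ys ys⊆xs refl))

  erase : List Bool → List A → List A
  erase []           xs       = xs
  erase (_ ∷ _)      []       = []
  erase (true ∷ bs)  (x ∷ xs) = erase bs xs
  erase (false ∷ bs) (x ∷ xs) = x ∷ erase bs xs

  erase-all : ∀ xs → erase (replicate (length xs) true) xs ≡ []
  erase-all []       = refl
  erase-all (x ∷ xs) = erase-all xs

trues : List Bool → ℕ
trues []           = 0
trues (true ∷ bs)  = suc (trues bs)
trues (false ∷ bs) = trues bs

trues-++ : ∀ bs cs → trues (bs ++ cs) ≡ trues bs + trues cs
trues-++ []           cs = refl
trues-++ (true ∷ bs)  cs = cong suc (trues-++ bs cs)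
trues-++ (false ∷ bs) cs = trues-++ bs cs

trues-replicate : ∀ n → trues (replicate n true) ≡ n
trues-replicate zero    = refl
trues-replicate (suc n) = cong suc (trues-replicate n)

patterns : ℕ → ℕ → List (List Bool)
patterns zero    zero    = [ [] ]
patterns zero    (suc k) = []
patterns (suc n) zero    = map (false ∷_) (patterns n zero)
patterns (suc n) (suc k) = map (true ∷_) (patterns n k) ++ map (false ∷_) (patterns n (suc k))

length-patterns : ∀ n k → length (patterns n k) ≡ n C k
length-patterns zero    zero    = refl
length-patterns zero    (suc k) = refl
length-patterns (suc n) zero    = trans (length-map (false ∷_) (patterns n zero)) (length-patterns n zero)
length-patterns (suc n) (suc k) = begin
  length (map (true ∷_) (patterns n k) ++ map (false ∷_) (patterns n (suc k)))
    ≡⟨ length-++ (map (true ∷_) (patterns n k)) ⟩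
  length (map (true ∷_) (patterns n k)) + length (map (false ∷_) (patterns n (suc k)))
    ≡⟨ cong₂ _+_ (trans (length-map _ (patterns n k)) (length-patterns n k))
                 (trans (length-map _ (patterns n (suc k))) (length-patterns n (suc k))) ⟩
  n C k + n C suc k
    ≡⟨ nCk+nC[k+1]≡[n+1]C[k+1] n k ⟩
  suc n C suc k ∎
  where open ≡-Reasoning

∈-patterns : ∀ {n k} bs → length bs ≡ n → trues bs ≡ k → bs ∈ patterns n k
∈-patterns                []           refl refl = here refl
∈-patterns                (true ∷ bs)  refl refl = ∈-++⁺ˡ (∈-map⁺ (true ∷_) (∈-patterns bs refl refl))
∈-patterns {k = zero}     (false ∷ bs) refl eq   = ∈-map⁺ (false ∷_) (∈-patterns bs refl eq)
∈-patterns {k = suc k}    (false ∷ bs) refl eq   =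
  ∈-++⁺ʳ (map (true ∷_) (patterns (length bs) k)) (∈-map⁺ (false ∷_) (∈-patterns bs refl eq))

module _ {s : ℕ} where

  Step-∷ : ∀ {U V : Word s} x → Step U V → Step (x ∷ U) (x ∷ V)
  Step-∷ x (ins u v a)   = ins (x ∷ u) v a
  Step-∷ x (del u v a)   = del (x ∷ u) v a
  Step-∷ x (sub u v a b) = sub (x ∷ u) v a b

  Edits-∷ : ∀ {k} {U V : Word s} x → Edits k U V → Edits k (x ∷ U) (x ∷ V)
  Edits-∷ x (done u)    = done (x ∷ u)
  Edits-∷ x (step st e) = step (Step-∷ x st) (Edits-∷ x e)

  LevLe-∷ : ∀ {k} {U W : Word s} x → LevLe U W k → LevLe (x ∷ U) (x ∷ W) k
  LevLe-∷ x (k′ , k′≤k , e) = k′ , k′≤k , Edits-∷ x e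

  LevLe-step : ∀ {k} {U V W : Word s} → Step U V → LevLe V W k → LevLe U W (suc k)
  LevLe-step st (k′ , k′≤k , e) = suc k′ , s≤s k′≤k , step st e

  LevLe-suc : ∀ {k} {U W : Word s} → LevLe U W k → LevLe U W (suc k)
  LevLe-suc (k′ , k′≤k , e) = k′ , m≤n⇒m≤1+n k′≤k , e

  snoc-step : ∀ (P : Word s) c → Step P (P ∷ʳ c)
  snoc-step P c = subst (λ V → Step V (P ∷ʳ c)) (++-identityʳ P) (ins P [] c)

  data Alignment : ℕ → Word s → Word s → Set where
    []     : Alignment 0 [] []
    match  : ∀ {k U W} x   → Alignment k U W → Alignment k (x ∷ U) (x ∷ W)
    sub    : ∀ {k U W} a x → Alignment k U W → Alignment (suc k) (a ∷ U) (x ∷ W)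
    ins    : ∀ {k U W} a   → Alignment k U W → Alignment (suc k) (a ∷ U) W
    del    : ∀ {k U W} x   → Alignment k U W → Alignment (suc k) U (x ∷ W)
    weaken : ∀ {k U W}     → Alignment k U W → Alignment (suc k) U W

  Alignment-refl : ∀ U → Alignment 0 U U
  Alignment-refl []      = []
  Alignment-refl (x ∷ U) = match x (Alignment-refl U)

  Alignment-++ : ∀ {k U V} u → Alignment k U V → Alignment k (u ++ U) (u ++ V)
  Alignment-++ []      al = al
  Alignment-++ (x ∷ u) al = match x (Alignment-++ u al)

  Alignment-mono : ∀ {k k′ U W} → k ≤ k′ → Alignment k U W → Alignment k′ U W
  Alignment-mono k≤k′ = go (≤⇒≤′ k≤k′)
    where
      go : ∀ {k k′ U W} → k ≤′ k′ → Alignment k U W → Alignment k′ U W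
      go ≤′-refl        = id
      go (≤′-step k≤k′) = weaken ∘ go k≤k′

  Step⇒Alignment : ∀ {U V} → Step U V → Alignment 1 U V
  Step⇒Alignment (ins u v a)   = Alignment-++ u (del a (Alignment-refl v))
  Step⇒Alignment (del u v a)   = Alignment-++ u (ins a (Alignment-refl v))
  Step⇒Alignment (sub u v a b) = Alignment-++ u (sub a b (Alignment-refl v))

  +-suc-cast : ∀ k m {U W} → Alignment (suc (k + m)) U W → Alignment (k + suc m) U W
  +-suc-cast k m {U} {W} = subst (λ n → Alignment n U W) (sym (+-suc k m))

  Alignment-trans : ∀ {k m U V X} → Alignment k U V → Alignment m V X → Alignment (k + m) U X
  Alignment-trans (ins a al)  al′ = ins a (Alignment-trans al al′)
  Alignment-trans (weaken al) al′ = weaken (Alignment-trans al al′)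
  Alignment-trans {k} {suc m} al (del x al′) =
    +-suc-cast k m (del x (Alignment-trans al al′))
  Alignment-trans {k} {suc m} al (weaken al′) =
    +-suc-cast k m (weaken (Alignment-trans al al′))
  Alignment-trans [] al′ = al′
  Alignment-trans (match x al) (match .x al′) = match x (Alignment-trans al al′)
  Alignment-trans {k} {suc m} (match x al) (sub .x b al′) =
    +-suc-cast k m (sub x b (Alignment-trans al al′))
  Alignment-trans {k} {suc m} (match x al) (ins .x al′) =
    +-suc-cast k m (ins x (Alignment-trans al al′))
  Alignment-trans (sub a x al) (match .x al′) = sub a x (Alignment-trans al al′)
  Alignment-trans {suc k} {suc m} (sub a x al) (sub .x b al′) =
    +-suc-cast (suc k) m (weaken (sub a b (Alignment-trans al al′)))
  Alignment-trans {suc k} {suc m} (sub a x al) (ins .x al′) =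
    +-suc-cast (suc k) m (weaken (ins a (Alignment-trans al al′)))
  Alignment-trans (del x al) (match .x al′) = del x (Alignment-trans al al′)
  Alignment-trans {suc k} {suc m} (del x al) (sub .x b al′) =
    +-suc-cast (suc k) m (weaken (del b (Alignment-trans al al′)))
  Alignment-trans {suc k} {suc m} (del x al) (ins .x al′) =
    +-suc-cast (suc k) m (weaken (weaken (Alignment-trans al al′)))

  Edits⇒Alignment : ∀ {k U W} → Edits k U W → Alignment k U W
  Edits⇒Alignment (done u)    = Alignment-refl u
  Edits⇒Alignment (step st e) = Alignment-trans (Step⇒Alignment st) (Edits⇒Alignment e)

  Alignment⇒LevLe : ∀ {k U W} → Alignment k U W → LevLe U W k
  Alignment⇒LevLe []                    = 0 , z≤n , done []
  Alignment⇒LevLe (match x al)          = LevLe-∷ x (Alignment⇒LevLe al)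
  Alignment⇒LevLe (sub {U = U} a x al)  = LevLe-step (sub [] U a x) (LevLe-∷ x (Alignment⇒LevLe al))
  Alignment⇒LevLe (ins {U = U} a al)    = LevLe-step (del [] U a) (Alignment⇒LevLe al)
  Alignment⇒LevLe (del {U = U} x al)    = LevLe-step (ins [] U x) (LevLe-∷ x (Alignment⇒LevLe al))
  Alignment⇒LevLe (weaken al)           = LevLe-suc (Alignment⇒LevLe al)

  Alignment-[]ˡ : ∀ {k W} → Alignment k [] W → length W ≤ k
  Alignment-[]ˡ []          = z≤n
  Alignment-[]ˡ (del x al)  = s≤s (Alignment-[]ˡ al)
  Alignment-[]ˡ (weaken al) = m≤n⇒m≤1+n (Alignment-[]ˡ al)

  Cheaper : ℕ → Word s → Word s → Set
  Cheaper k U W = ∃ λ k′ → k′ < k × Alignment k′ U W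

  PrefixWithin : ℕ → Word s → Word s → Set
  PrefixWithin k U W = ∃₂ λ P c → U ≡ P ∷ʳ c × Alignment k P W

  Reducible : ℕ → Word s → Word s → Set
  Reducible k U W = Cheaper k U W ⊎ PrefixWithin k U W

  Reducible-extend : ∀ {k U W W′} n u →
                     (∀ {k V} → Alignment k V W → Alignment (n + k) (u ++ V) W′) →
                     Reducible k U W → Reducible (n + k) (u ++ U) W′
  Reducible-extend n u extend (inj₁ (k′ , k′<k , al)) =
    inj₁ (n + k′ , +-monoʳ-< n k′<k , extend al)
  Reducible-extend n u extend (inj₂ (P , c , refl , al)) =
    inj₂ (u ++ P , c , sym (++-assoc u P [ c ]) , extend al)

  -- In a canonical alignment the last letter of U is always matched.
  data Canonical⁺ : ℕ → Word s → Word s → Set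
  data Canonical  : ℕ → Word s → Word s → Set

  data Canonical⁺ where
    del       : ∀ {k U W} x   → Canonical⁺ k U W → Canonical⁺ (suc k) U (x ∷ W)
    sub       : ∀ {k U W} x a → a ≢ x → Canonical⁺ k U W → Canonical⁺ (suc k) (a ∷ U) (x ∷ W)
    ins-match : ∀ {k U W} x as → All (_≢ x) as → Canonical k U W →
                Canonical⁺ (length as + k) (as ++ x ∷ U) (x ∷ W)

  data Canonical where
    nonempty   : ∀ {k U W} → Canonical⁺ k U W → Canonical k U W
    delete-all : ∀ {W} → Canonical (length W) [] W

  Canonical⁺⇒Alignment : ∀ {k U W} → Canonical⁺ k U W → Alignment k U W
  Canonical⇒Alignment  : ∀ {k U W} → Canonical k U W → Alignment k U W

  Canonical⁺⇒Alignment (del x c)            = del x (Canonical⁺⇒Alignment c)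
  Canonical⁺⇒Alignment (sub x a _ c)        = sub a x (Canonical⁺⇒Alignment c)
  Canonical⁺⇒Alignment (ins-match x as _ c) = insert-all as (match x (Canonical⇒Alignment c))
    where
      insert-all : ∀ {k U W} as → Alignment k U W → Alignment (length as + k) (as ++ U) W
      insert-all []       al = al
      insert-all (a ∷ as) al = ins a (insert-all as al)

  Canonical⇒Alignment (nonempty c)         = Canonical⁺⇒Alignment c
  Canonical⇒Alignment (delete-all {[]})    = []
  Canonical⇒Alignment (delete-all {x ∷ W}) = del x (Canonical⇒Alignment delete-all)

  Normal : ℕ → Word s → Word s → Set
  Normal k U W = Canonical k U W ⊎ Reducible k U W

  normal-match : ∀ {k U W} x → Normal k U W → Normal k (x ∷ U) (x ∷ W)
  normal-match x (inj₁ c) = inj₁ (nonempty (ins-match x [] [] c))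
  normal-match x (inj₂ r) = inj₂ (Reducible-extend 0 [ x ] (match x) r)

  normal-sub : ∀ {k U W} x a → a ≢ x → Normal k U W → Normal (suc k) (a ∷ U) (x ∷ W)
  normal-sub x a a≢x (inj₁ (nonempty c)) = inj₁ (nonempty (sub x a a≢x c))
  normal-sub x a a≢x (inj₁ delete-all)   =
    inj₂ (inj₂ ([] , a , refl , del x (Canonical⇒Alignment delete-all)))
  normal-sub x a a≢x (inj₂ r)            = inj₂ (Reducible-extend 1 [ a ] (sub a x) r)

  normal-del : ∀ {k U W} x → Normal k U W → Normal (suc k) U (x ∷ W)
  normal-del x (inj₁ (nonempty c)) = inj₁ (nonempty (del x c))
  normal-del x (inj₁ delete-all)   = inj₁ delete-all
  normal-del x (inj₂ r)            = inj₂ (Reducible-extend 1 [] (del x) r)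

  normal-ins⁺  : ∀ W {k U} a → Canonical⁺ k U W → Normal (suc k) (a ∷ U) W
  normal-ins   : ∀ W {k U} a → Normal k U W → Normal (suc k) (a ∷ U) W
  normal-ins++ : ∀ W {k U} as → Normal k U W → Normal (length as + k) (as ++ U) W

  normal-ins⁺ (x ∷ W) a (del .x c) = inj₂ (inj₁ (_ , n<1+n _ , sub a x (Canonical⁺⇒Alignment c)))
  normal-ins⁺ (x ∷ W) a (sub .x b b≢x c) with a ≟ x
  ... | yes refl = inj₂ (inj₁ (_ , n<1+n _ , match x (ins b (Canonical⁺⇒Alignment c))))
  ... | no a≢x   = normal-sub x a a≢x (normal-ins W b (inj₁ (nonempty c)))
  normal-ins⁺ (x ∷ W) a (ins-match {k} {U} .x as as≢x c) with a ≟ x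
  ... | no a≢x   = inj₁ (nonempty (ins-match x (a ∷ as) (a≢x ∷ as≢x) c))
  ... | yes refl =
    -- match a against x instead, and insert as and then x in front of U
    normal-match x (subst (λ n → Normal n (as ++ x ∷ U) W) (+-suc (length as) k)
                          (normal-ins++ W as (normal-ins W x (inj₁ c))))

  normal-ins W a (inj₁ (nonempty c)) = normal-ins⁺ W a c
  normal-ins W a (inj₁ delete-all)   =
    inj₂ (inj₂ ([] , a , refl , weaken (Canonical⇒Alignment delete-all)))
  normal-ins W a (inj₂ r)            = inj₂ (Reducible-extend 1 [ a ] (ins a) r)

  normal-ins++ W []       n = n
  normal-ins++ W (a ∷ as) n = normal-ins W a (normal-ins++ W as n)

  normalise : ∀ {k U W} → Alignment k U W → Normal k U W
  normalise []                 = inj₁ delete-all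
  normalise (match x al)       = normal-match x (normalise al)
  normalise (sub a x al)       with a ≟ x
  ... | yes refl = inj₂ (inj₁ (_ , n<1+n _ , match x al))
  ... | no a≢x   = normal-sub x a a≢x (normalise al)
  normalise {W = W} (ins a al) = normal-ins W a (normalise al)
  normalise (del x al)         = normal-del x (normalise al)
  normalise (weaken al)        = inj₂ (inj₁ (_ , n<1+n _ , al))

module _ {r : ℕ} where

  -- decode R subs blocks ℓ rebuilds a word from the letters R of W that are not deleted: subs
  -- marks the substituted ones, blocks lists, before each matched letter, one true per inserted
  -- letter followed by a false, and ℓ supplies the new letters, each punched in around the
  -- letter of R it replaces or precedes.
  decode : Word (suc r) → List Bool → List Bool → List (Fin r) → Word (suc r)
  decode (x ∷ R) (true ∷ subs)  blocks           (a ∷ ℓ) = punchIn x a ∷ decode R subs blocks ℓ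
  decode (x ∷ R) (false ∷ subs) (true ∷ blocks)  (a ∷ ℓ) = punchIn x a ∷ decode (x ∷ R) (false ∷ subs) blocks ℓ
  decode (x ∷ R) (false ∷ subs) (false ∷ blocks) ℓ       = x ∷ decode R subs blocks ℓ
  decode _       _              _                _       = []

  punchOuts : ∀ x (as : Word (suc r)) → All (_≢ x) as → List (Fin r)
  punchOuts x []       []             = []
  punchOuts x (a ∷ as) (a≢x ∷ as≢x) = punchOut (a≢x ∘ sym) ∷ punchOuts x as as≢x

  length-punchOuts : ∀ x as as≢x → length (punchOuts x as as≢x) ≡ length as
  length-punchOuts x []       []             = refl
  length-punchOuts x (a ∷ as) (a≢x ∷ as≢x) = cong suc (length-punchOuts x as as≢x)

  decode-block : ∀ x R subs blocks ℓ as as≢x →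
                 decode (x ∷ R) (false ∷ subs) (replicate (length as) true ++ false ∷ blocks)
                        (punchOuts x as as≢x ++ ℓ)
                   ≡ as ++ x ∷ decode R subs blocks ℓ
  decode-block x R subs blocks ℓ []       []             = refl
  decode-block x R subs blocks ℓ (a ∷ as) (a≢x ∷ as≢x) =
    cong₂ _∷_ (punchIn-punchOut _) (decode-block x R subs blocks ℓ as as≢x)

  -- i deletions, j substitutions, m insertions and f + 1 matches, the last match being implicit
  -- in the final false appended to substituted and to inserted.
  record Code (k : ℕ) (U W : Word (suc r)) : Set where
    field
      i j f m                      : ℕ
      deleted substituted inserted : List Bool
      letters                      : List (Fin r)
      length-W                     : length W ≡ i + suc (j + f)
      length-deleted               : length deleted ≡ length W
      trues-deleted                : trues deleted ≡ i
      length-substituted           : length substituted ≡ j + f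
      trues-substituted            : trues substituted ≡ j
      length-inserted              : length inserted ≡ f + m
      trues-inserted               : trues inserted ≡ m
      length-letters               : length letters ≡ j + m
      cost                         : k ≡ i + (j + m)
      decodes                      : decode (erase deleted W) (substituted ∷ʳ false) (inserted ∷ʳ false) letters
                                       ≡ U

  Code-del : ∀ {k U W} x → Code k U W → Code (suc k) U (x ∷ W)
  Code-del x c = record
    { i                  = suc i
    ; deleted            = true ∷ deleted
    ; length-W           = cong suc length-W
    ; length-deleted     = cong suc length-deleted
    ; trues-deleted      = cong suc trues-deleted
    ; cost               = cong suc cost
    ; j = j ; f = f ; m = m ; substituted = substituted ; inserted = inserted ; letters = letters
    ; length-substituted = length-substituted ; trues-substituted = trues-substituted
    ; length-inserted = length-inserted ; trues-inserted = trues-inserted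
    ; length-letters = length-letters ; decodes = decodes
    }
    where open Code c

  Code-sub : ∀ {k U W} x a → a ≢ x → Code k U W → Code (suc k) (a ∷ U) (x ∷ W)
  Code-sub x a a≢x c = record
    { j                  = suc j
    ; deleted            = false ∷ deleted
    ; substituted        = true ∷ substituted
    ; letters            = punchOut (a≢x ∘ sym) ∷ letters
    ; length-W           = trans (cong suc length-W) (sym (+-suc i (suc (j + f))))
    ; length-deleted     = cong suc length-deleted
    ; length-substituted = cong suc length-substituted
    ; trues-substituted  = cong suc trues-substituted
    ; length-letters     = cong suc length-letters
    ; cost               = trans (cong suc cost) (sym (+-suc i (j + m)))
    ; decodes            = cong₂ _∷_ (punchIn-punchOut _) decodes
    ; i = i ; f = f ; m = m ; inserted = inserted
    ; trues-deleted = trues-deleted ; length-inserted = length-inserted ; trues-inserted = trues-inserted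
    }
    where open Code c

  Code-ins-match : ∀ {k U W} x as (as≢x : All (_≢ x) as) → Code k U W →
                   Code (length as + k) (as ++ x ∷ U) (x ∷ W)
  Code-ins-match {W = W} x as as≢x c = record
    { f                  = suc f
    ; m                  = n + m
    ; deleted            = false ∷ deleted
    ; substituted        = false ∷ substituted
    ; inserted           = block ++ false ∷ inserted
    ; letters            = punchOuts x as as≢x ++ letters
    ; length-W           = trans (cong suc length-W) (+-suc-inner i j f)
    ; length-deleted     = cong suc length-deleted
    ; length-substituted = trans (cong suc length-substituted) (sym (+-suc j f))
    ; length-inserted    = trans (length-++ block)
                                 (trans (cong₂ (λ a b → a + suc b) (length-replicate n) length-inserted)
                                        (+-suc-middle n f m))
    ; trues-inserted     = trans (trues-++ block (false ∷ inserted))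
                                 (cong₂ _+_ (trues-replicate n) trues-inserted)
    ; length-letters     = trans (length-++ (punchOuts x as as≢x))
                                 (trans (cong₂ _+_ (length-punchOuts x as as≢x) length-letters)
                                        (+-left-comm n j m))
    ; cost               = trans (cong (n +_) cost) (+-left-comm-3 n i j m)
    ; decodes            = begin
        decode (x ∷ R) S ((block ++ false ∷ inserted) ∷ʳ false) ℓ
          ≡⟨ cong (λ bs → decode (x ∷ R) S bs ℓ) (++-assoc block (false ∷ inserted) [ false ]) ⟩
        decode (x ∷ R) S (block ++ false ∷ inserted ∷ʳ false) ℓ
          ≡⟨ decode-block x R (substituted ∷ʳ false) (inserted ∷ʳ false) letters as as≢x ⟩
        as ++ x ∷ decode R (substituted ∷ʳ false) (inserted ∷ʳ false) letters
          ≡⟨ cong (λ V → as ++ x ∷ V) decodes ⟩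
        as ++ x ∷ _ ∎
    ; i = i ; j = j ; trues-deleted = trues-deleted ; trues-substituted = trues-substituted
    }
    where
      open Code c
      open ≡-Reasoning
      n     = length as
      block = replicate n true
      R     = erase deleted W
      S     = false ∷ substituted ∷ʳ false
      ℓ     = punchOuts x as as≢x ++ letters
      +-suc-inner : ∀ i j f → suc (i + suc (j + f)) ≡ i + suc (j + suc f)
      +-suc-inner = solve-∀
      +-suc-middle : ∀ n f m → n + suc (f + m) ≡ suc f + (n + m)
      +-suc-middle = solve-∀
      +-left-comm : ∀ n j m → n + (j + m) ≡ j + (n + m)
      +-left-comm = solve-∀
      +-left-comm-3 : ∀ n i j m → n + (i + (j + m)) ≡ i + (j + (n + m))
      +-left-comm-3 = solve-∀

  Code-delete-all : ∀ {W} x as (as≢x : All (_≢ x) as) →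
                    Code (length as + length W) (as ++ [ x ]) (x ∷ W)
  Code-delete-all {W} x as as≢x = record
    { i                  = length W
    ; j                  = 0
    ; f                  = 0
    ; m                  = length as
    ; deleted            = false ∷ replicate (length W) true
    ; substituted        = []
    ; inserted           = replicate (length as) true
    ; letters            = punchOuts x as as≢x
    ; length-W           = +-comm 1 (length W)
    ; length-deleted     = cong suc (length-replicate (length W))
    ; trues-deleted      = trues-replicate (length W)
    ; length-substituted = refl
    ; trues-substituted  = refl
    ; length-inserted    = length-replicate (length as)
    ; trues-inserted     = trues-replicate (length as)
    ; length-letters     = length-punchOuts x as as≢x
    ; cost               = +-comm (length as) (length W)
    ; decodes            = begin
        decode (x ∷ erase (replicate (length W) true) W) [ false ] (replicate (length as) true ++ [ false ])
               (punchOuts x as as≢x)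
          ≡⟨ cong₂ (λ R letters → decode (x ∷ R) [ false ] (replicate (length as) true ++ [ false ]) letters)
                   (erase-all W) (sym (++-identityʳ (punchOuts x as as≢x))) ⟩
        decode [ x ] [ false ] (replicate (length as) true ++ [ false ]) (punchOuts x as as≢x ++ [])
          ≡⟨ decode-block x [] [] [] [] as as≢x ⟩
        as ++ [ x ] ∎
    }
    where open ≡-Reasoning

  code : ∀ {k U W} → Canonical⁺ k U W → Code k U W
  code (del x c)                          = Code-del x (code c)
  code (sub x a a≢x c)                    = Code-sub x a a≢x (code c)
  code (ins-match x as as≢x (nonempty c)) = Code-ins-match x as as≢x (code c)
  code (ins-match x as as≢x delete-all)   = Code-delete-all x as as≢x

  module Candidates (w : ℕ) (W : Word (suc r)) (d : ℕ) where

    insertionLength : ℕ → ℕ → ℕ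
    insertionLength i j = (w + d) ∸ (2 * i) ∸ (2 * j) ∸ 1

    withSubstitutions : ℕ → ℕ → List Bool → List (Fin r) → List Bool → List (Word (suc r))
    withSubstitutions i j deleted letters substituted =
      map (λ inserted → decode (erase deleted W) (substituted ∷ʳ false) (inserted ∷ʳ false) letters)
          (patterns (insertionLength i j) (d ∸ i ∸ j))

    withSubstitutionCount : ℕ → List Bool → List (Fin r) → ℕ → List (Word (suc r))
    withSubstitutionCount i deleted letters j =
      patterns (w ∸ i ∸ 1) j >>= withSubstitutions i j deleted letters

    withLetters : ℕ → List Bool → List (Fin r) → List (Word (suc r))
    withLetters i deleted letters = upTo (suc (d ∸ i)) >>= withSubstitutionCount i deleted letters

    withDeletions : ℕ → List Bool → List (Word (suc r))
    withDeletions i deleted = allLists (allFin r) (d ∸ i) >>= withLetters i deleted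

    withDeletionCount : ℕ → List (Word (suc r))
    withDeletionCount i = patterns w i >>= withDeletions i

    candidates : List (Word (suc r))
    candidates = upTo (suc d) >>= withDeletionCount

    patternPairs : ℕ → ℕ → ℕ
    patternPairs i j = ((w ∸ i ∸ 1) C j) * (insertionLength i j C (d ∸ i ∸ j))

    length-withSubstitutionCount : ∀ i deleted letters j →
                                   length (withSubstitutionCount i deleted letters j) ≡ patternPairs i j
    length-withSubstitutionCount i deleted letters j = begin
      length (withSubstitutionCount i deleted letters j)
        ≡⟨ length-concatMap-const (withSubstitutions i j deleted letters) (patterns (w ∸ i ∸ 1) j) (λ _ →
             trans (length-map _ (patterns n (d ∸ i ∸ j))) (length-patterns n (d ∸ i ∸ j))) ⟩
      length (patterns (w ∸ i ∸ 1) j) * (n C (d ∸ i ∸ j))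
        ≡⟨ cong (_* (n C (d ∸ i ∸ j))) (length-patterns (w ∸ i ∸ 1) j) ⟩
      patternPairs i j ∎
      where
        open ≡-Reasoning
        n = insertionLength i j

    length-withDeletions : ∀ i deleted →
                           length (withDeletions i deleted) ≡ r ^ (d ∸ i) * sumTo (d ∸ i) (patternPairs i)
    length-withDeletions i deleted = begin
      length (withDeletions i deleted)
        ≡⟨ length-concatMap-const (withLetters i deleted) (allLists (allFin r) (d ∸ i)) (λ letters →
             length-concatMap (withSubstitutionCount i deleted letters) (upTo (suc (d ∸ i)))
                              (length-withSubstitutionCount i deleted letters)) ⟩
      length (allLists (allFin r) (d ∸ i)) * Σj
        ≡⟨ cong (_* Σj) (length-allLists (allFin r) (d ∸ i)) ⟩
      length (allFin r) ^ (d ∸ i) * Σj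
        ≡⟨ cong (λ n → n ^ (d ∸ i) * Σj) (length-tabulate id) ⟩
      r ^ (d ∸ i) * Σj ∎
      where
        open ≡-Reasoning
        Σj = sumTo (d ∸ i) (patternPairs i)

    length-candidates : length candidates ≡ bound (suc r) w d
    length-candidates = length-concatMap withDeletionCount (upTo (suc d)) λ i →
      let Σj = sumTo (d ∸ i) (patternPairs i) in begin
      length (withDeletionCount i)
        ≡⟨ length-concatMap-const (withDeletions i) (patterns w i) (length-withDeletions i) ⟩
      length (patterns w i) * (r ^ (d ∸ i) * Σj)
        ≡⟨ cong (_* (r ^ (d ∸ i) * Σj)) (length-patterns w i) ⟩
      (w C i) * (r ^ (d ∸ i) * Σj)
        ≡⟨ *-assoc (w C i) (r ^ (d ∸ i)) Σj ⟨
      (w C i) * r ^ (d ∸ i) * Σj ∎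
      where open ≡-Reasoning

  open Candidates public using (candidates; length-candidates)

  ∸-insertionLength : ∀ i j f m → (i + suc (j + f) + (i + (j + m))) ∸ (2 * i) ∸ (2 * j) ∸ 1 ≡ f + m
  ∸-insertionLength i j f m = begin
    (i + suc (j + f) + (i + (j + m))) ∸ (2 * i) ∸ (2 * j) ∸ 1
      ≡⟨ cong (λ n → n ∸ (2 * i) ∸ (2 * j) ∸ 1) (regroup i j f m) ⟩
    (2 * i + (2 * j + suc (f + m))) ∸ (2 * i) ∸ (2 * j) ∸ 1
      ≡⟨ cong (λ n → n ∸ (2 * j) ∸ 1) (m+n∸m≡n (2 * i) _) ⟩
    (2 * j + suc (f + m)) ∸ (2 * j) ∸ 1
      ≡⟨ cong (_∸ 1) (m+n∸m≡n (2 * j) _) ⟩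
    f + m ∎
    where
      open ≡-Reasoning
      regroup : ∀ i j f m → i + suc (j + f) + (i + (j + m)) ≡ 2 * i + (2 * j + suc (f + m))
      regroup = solve-∀

  Code⇒∈candidates : ∀ {d U W} → Code d U W → U ∈ candidates (length W) W d
  Code⇒∈candidates {d} {U} {W} c =
    subst₂ (λ w d → U ∈ candidates w W d) (sym length-W) (sym cost)
      (∈-concatMap withDeletionCount (∈-upTo⁺ (s≤s (m≤m+n i (j + m))))
      (∈-concatMap (withDeletions i) deleted∈
      (∈-concatMap (withLetters i deleted) letters∈
      (∈-concatMap (withSubstitutionCount i deleted letters) j∈
      (∈-concatMap (withSubstitutions i j deleted letters) substituted∈
      (subst (_∈ withSubstitutions i j deleted letters substituted) decodes (∈-map⁺ _ inserted∈)))))))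
    where
      open Code c
      open Candidates (i + suc (j + f)) W (i + (j + m))
        using ( insertionLength; withDeletionCount; withDeletions; withLetters
              ; withSubstitutionCount; withSubstitutions)
      d∸i : (i + (j + m)) ∸ i ≡ j + m
      d∸i = m+n∸m≡n i (j + m)
      w∸i∸1 : (i + suc (j + f)) ∸ i ∸ 1 ≡ j + f
      w∸i∸1 = cong (_∸ 1) (m+n∸m≡n i (suc (j + f)))
      d∸i∸j : (i + (j + m)) ∸ i ∸ j ≡ m
      d∸i∸j = trans (cong (_∸ j) d∸i) (m+n∸m≡n j m)
      deleted∈ : deleted ∈ patterns (i + suc (j + f)) i
      deleted∈ = ∈-patterns deleted (trans length-deleted length-W) trues-deleted
      letters∈ : letters ∈ allLists (allFin r) ((i + (j + m)) ∸ i)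
      letters∈ = ∈-allLists letters (All.tabulate λ {a} _ → ∈-allFin a) (trans length-letters (sym d∸i))
      j∈ : j ∈ upTo (suc ((i + (j + m)) ∸ i))
      j∈ = ∈-upTo⁺ (s≤s (subst (j ≤_) (sym d∸i) (m≤m+n j m)))
      substituted∈ : substituted ∈ patterns ((i + suc (j + f)) ∸ i ∸ 1) j
      substituted∈ = ∈-patterns substituted (trans length-substituted (sym w∸i∸1)) trues-substituted
      inserted∈ : inserted ∈ patterns (insertionLength i j) ((i + (j + m)) ∸ i ∸ j)
      inserted∈ = ∈-patterns inserted (trans length-inserted (sym (∸-insertionLength i j f m)))
                                      (trans trues-inserted (sym d∸i∸j))

module _ {s : ℕ} where

  InCN⇒¬Reducible : ∀ {W : Word s} {d U} → d < length W → InCN W d U → ¬ Reducible d U W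
  InCN⇒¬Reducible {W} {U = U} d<w (_ , no-prefix) (inj₁ (k , k<d , al)) with initLast U
  ... | []      = <⇒≱ (<-trans k<d d<w) (Alignment-[]ˡ al)
  ... | P ∷ʳ′ c = no-prefix (P , c , [] , refl , Alignment⇒LevLe (Alignment-mono k<d P-aligned))
    where
      P-aligned : Alignment (suc k) P W
      P-aligned = Alignment-trans (Step⇒Alignment (snoc-step P c)) al
  InCN⇒¬Reducible d<w (_ , no-prefix) (inj₂ (P , c , refl , al)) =
    no-prefix (P , c , [] , refl , Alignment⇒LevLe al)

  InCN⇒Canonical⁺ : ∀ {W : Word s} {d U} → d < length W → InCN W d U → Canonical⁺ d U W
  InCN⇒Canonical⁺ d<w U∈CN@((k , k≤d , edits) , _)
    with normalise (Alignment-mono k≤d (Edits⇒Alignment edits))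
  ... | inj₁ (nonempty c) = c
  ... | inj₁ delete-all   = contradiction d<w (<-irrefl refl)
  ... | inj₂ reducible    = contradiction reducible (InCN⇒¬Reducible d<w U∈CN)

proposition4 : (s : ℕ) (W : Word s) (d : ℕ) → d < length W →
    (L : List (Word s)) → Unique L → All (InCN W d) L →
    length L ≤ bound s (length W) d
proposition4 zero    []       _ ()
proposition4 zero    (() ∷ _)
proposition4 (suc r) W d d<w L L-unique L-in-CN = begin
  length L                           ≤⟨ Unique⇒length≤ L-unique L⊆candidates ⟩
  length (candidates (length W) W d) ≡⟨ length-candidates (length W) W d ⟩
  bound (suc r) (length W) d         ∎
  where
    open ≤-Reasoning
    L⊆candidates : L ⊆ candidates (length W) W d
    L⊆candidates U∈L = Code⇒∈candidates (code (InCN⇒Canonical⁺ d<w (All.lookup L-in-CN U∈L)))
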